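{- Let $\psi_1: 0\mapsto 01,\ 1\mapsto 0$ and $\psi_3: 0\mapsto 0,\ 1\mapsto 01$ be morphisms of $\{0,1\}^*$, and let $\gamma=\psi_{i_1}\circ\cdots\circ\psi_{i_m}$ with $m\ge 0$ and each $i_k\in\{1,3\}$. Then the word $\gamma(0)$ ends with the letter $0$ if and only if the number of indices $k$ with $i_k=1$ is even. -}

module Defs where

open import Data.List using (List; []; _∷_; _++_; concatMap; foldr; length; filter)
open import Relation.Binary.PropositionalEquality using (_≡_; refl)
open import Relation.Nullary using (yes; no)
open import Data.Nat using (ℕ)
open import Relation.Nullary.Decidable using (Dec)

data Letter : Set where
  l0 l1 : Letter

Word : Set
Word = List Letter

extend : (Letter → Word) → Word → Word
extend f w = concatMap f w

ψ₁ : Word → Word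
ψ₁ = extend λ { l0 → l0 ∷ l1 ∷ [] ; l1 → l0 ∷ [] }

ψ₃ : Word → Word
ψ₃ = extend λ { l0 → l0 ∷ [] ; l1 → l0 ∷ l1 ∷ [] }

data Idx : Set where
  one three : Idx

ψ : Idx → Word → Word
ψ one   = ψ₁
ψ three = ψ₃

-- γ = ψ_{i₁} ∘ ⋯ ∘ ψ_{i_m} for the index list i₁ ∷ ⋯ ∷ i_m ∷ []
-- (the empty list gives the identity)
compose : List Idx → Word → Word
compose []       w = w
compose (i ∷ is) w = ψ i (compose is w)

isOne? : (i : Idx) → Dec (i ≡ one)
isOne? one   = yes refl
isOne? three = no λ ()

countOnes : List Idx → ℕ
countOnes is = length (filter isOne? is)

module Submission where

-- A morphism f of {0,1}* maps a word ending in the letter c to a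
-- word ending in the last letter of f(c), because f(u c) = f(u) f(c).
-- Letter by letter, ψ₁ sends a final letter c to its complement
-- (0 ↦ 01, 1 ↦ 0) while ψ₃ preserves it (0 ↦ 0, 1 ↦ 01).  Hence
-- γ(0) = ψ_{i₁}(⋯ψ_{i_m}(0)⋯) ends with 0 complemented once for every
-- index equal to 1, i.e. with the letter of the parity of that count.

open import Defs
open import Data.List using (List; []; _∷_; _++_; _∷ʳ_; last)
open import Data.List.Properties using (++-assoc; concatMap-++)
open import Data.Maybe using (just)
open import Data.Maybe.Properties using (just-injective)
open import Data.Nat using (ℕ; zero; suc; _+_)
open import Data.Nat.Divisibility using (_∣_; _∣0; ∣-refl; ∣m∣n⇒∣m+n; ∣m+n∣m⇒∣n; ∣1⇒≡1)
open import Data.Product using (Σ; _,_)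
open import Relation.Binary.PropositionalEquality using (_≡_; refl; cong; module ≡-Reasoning)
open import Function.Bundles using (_⇔_; mk⇔)
import Function.Properties.Equivalence as ⇔

Ends : {A : Set} → List A → A → Set
Ends {A} w c = Σ (List A) λ u → w ≡ u ∷ʳ c

last-∷ʳ : {A : Set} (u : List A) (c : A) → last (u ∷ʳ c) ≡ just c
last-∷ʳ []          c = refl
last-∷ʳ (_ ∷ [])    c = refl
last-∷ʳ (_ ∷ y ∷ u) c = last-∷ʳ (y ∷ u) c

extend-ends : (f : Letter → Word) {w : Word} {c d : Letter} →
  Ends (extend f (c ∷ [])) d → Ends w c → Ends (extend f w) d
extend-ends f {c = c} {d} (v , fc≡vd) (u , refl) = extend f u ++ v , proof
  where
  open ≡-Reasoning
  proof : extend f (u ∷ʳ c) ≡ (extend f u ++ v) ∷ʳ d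
  proof = begin
    extend f (u ∷ʳ c)                ≡⟨ concatMap-++ f u (c ∷ []) ⟩
    extend f u ++ extend f (c ∷ [])  ≡⟨ cong (extend f u ++_) fc≡vd ⟩
    extend f u ++ (v ∷ʳ d)           ≡⟨ ++-assoc (extend f u) v (d ∷ []) ⟨
    (extend f u ++ v) ∷ʳ d           ∎

complement : Letter → Letter
complement l0 = l1
complement l1 = l0

parityLetter : ℕ → Letter
parityLetter zero    = l0
parityLetter (suc n) = complement (parityLetter n)

2∣2+n⇔2∣n : (n : ℕ) → (2 ∣ 2 + n) ⇔ (2 ∣ n)
2∣2+n⇔2∣n n = mk⇔ (λ 2∣2+n → ∣m+n∣m⇒∣n 2∣2+n ∣-refl) (∣m∣n⇒∣m+n ∣-refl)

complement-involutive : (l : Letter) → complement (complement l) ≡ l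
complement-involutive l0 = refl
complement-involutive l1 = refl

parityLetter-even : (n : ℕ) → (parityLetter n ≡ l0) ⇔ (2 ∣ n)
parityLetter-even zero          = mk⇔ (λ _ → 2 ∣0) (λ _ → refl)
parityLetter-even (suc zero)    = mk⇔ (λ ()) (λ 2∣1 → 2≢1 (∣1⇒≡1 2∣1))
  where
  2≢1 : 2 ≡ 1 → l1 ≡ l0
  2≢1 ()
parityLetter-even (suc (suc n))
  rewrite complement-involutive (parityLetter n)
  = ⇔.trans (parityLetter-even n) (⇔.sym (2∣2+n⇔2∣n n))

finalLetter : Idx → Letter → Letter
finalLetter one   = complement
finalLetter three = λ c → c

ψ-letter-ends : (i : Idx) (c : Letter) → Ends (ψ i (c ∷ [])) (finalLetter i c)
ψ-letter-ends one   l0 = l0 ∷ [] , refl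
ψ-letter-ends one   l1 = [] , refl
ψ-letter-ends three l0 = [] , refl
ψ-letter-ends three l1 = l0 ∷ [] , refl

ψ-ends : (i : Idx) {w : Word} {c : Letter} → Ends w c → Ends (ψ i w) (finalLetter i c)
ψ-ends one   = extend-ends _ (ψ-letter-ends one _)
ψ-ends three = extend-ends _ (ψ-letter-ends three _)

compose-ends : (is : List Idx) → Ends (compose is (l0 ∷ [])) (parityLetter (countOnes is))
compose-ends []           = [] , refl
compose-ends (one ∷ is)   = ψ-ends one (compose-ends is)
compose-ends (three ∷ is) = ψ-ends three (compose-ends is)

lemma3 : (is : List Idx) →
    (last (compose is (l0 ∷ [])) ≡ just l0) ⇔ (2 ∣ countOnes is)
lemma3 is with compose-ends is
... | u , γ0≡ul
  rewrite γ0≡ul | last-∷ʳ u (parityLetter (countOnes is))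
  = ⇔.trans (mk⇔ just-injective (cong just)) (parityLetter-even (countOnes is))
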